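{- Let $G$ be a finite connected undirected multigraph with vertex set $V$, $q\in V$ fixed. For each $v\in V$ let $\ell_v$ be a positive integer multiple of $\operatorname{ord}_q(v)$, let $\mathcal{P}=\{\ell_vv:v\in V\}$ and, for $[D]\in\operatorname{Jac}(G)$, $\mathcal{S}_{[D]}=\{E\in\mathbb{E}_{[D]}:E(v)<\ell_v\text{ for all }v\in V\}$. Then for each $[D]\in\operatorname{Jac}(G)$, \[\Lambda_{[D]}(z)=\frac{S(z)}{\prod_{v\in V}(1-z^{\ell_v})},\qquad S(z)=\sum_{F\in\mathcal{S}_{[D]}}z^{\deg(F)}.\]
   Context: Divisors on $G$ are elements of $\mathbb{Z}V$ with degree $\deg(D)=\sum_vD(v)$. The Laplacian $L:\mathbb{Z}^V\to\mathbb{Z}^V$ is $(Lf)(v)=\sum_{\text{edges }vw}(f(v)-f(w))$; principal divisors are $\sum_v(Lf)(v)v$; $D\sim D'$ if $D-D'$ is principal. $\operatorname{Jac}(G)$ is degree-$0$ divisors modulo principal divisors; $[D]$ is the class of $D$. $E$ is effective if $E(v)\ge0$ for all $v$; $|D|=\{E\ge 0: E\sim D\}$. $\mathbb{E}_{[D]}=\bigcup_{k\ge0}|D+kq|$. $\operatorname{ord}_q(v)$ is the order of $[v-q]\in\operatorname{Jac}(G)$. $\lambda_{[D]}(k)=\#|D+kq|$ and $\Lambda_{[D]}(z)=\sum_{k\ge0}\lambda_{[D]}(k)z^k$. -}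

module Defs where

open import Data.Nat as ℕ using (ℕ; zero; suc; _∸_; _≡ᵇ_)
open import Data.Integer as ℤ using (ℤ; +_; 0ℤ; 1ℤ)
open import Data.Fin using (Fin; zero; suc; _≟_)
open import Data.Vec using (Vec; lookup; tabulate; zipWith; map)
open import Data.List using (List; length)
open import Data.List.Membership.Propositional using (_∈_)
open import Data.List.Relation.Unary.Unique.Propositional using (Unique)
open import Data.Product using (Σ; ∃; _×_)
open import Data.Bool using (if_then_else_)
open import Relation.Nullary using (¬_)
open import Relation.Nullary.Decidable using (⌊_⌋)
open import Relation.Binary.PropositionalEquality using (_≡_)

-- A finite multigraph on vertex set Fin n is given by its (symmetric)
-- adjacency-multiplicity matrix A : Fin n → Fin n → ℕ.
Graph : ℕ → Set
Graph n = Fin n → Fin n → ℕ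

Symmetric : ∀ {n} → Graph n → Set
Symmetric A = ∀ u v → A u v ≡ A v u

data Reach {n} (A : Graph n) : Fin n → Fin n → Set where
  here : ∀ {u} → Reach A u u
  step : ∀ {u w v} → 1 ℕ.≤ A u w → Reach A w v → Reach A u v

Connected : ∀ {n} → Graph n → Set
Connected A = ∀ u v → Reach A u v

sumFin : ∀ {n} → (Fin n → ℤ) → ℤ
sumFin {zero} f = 0ℤ
sumFin {suc n} f = f zero ℤ.+ sumFin (λ i → f (suc i))

-- divisors: elements of ℤV, represented as vectors indexed by vertices
Div : ℕ → Set
Div n = Vec ℤ n

deg : ∀ {n} → Div n → ℤ
deg D = sumFin (lookup D)

infixl 6 _⊕_ _⊖_
infixr 7 _·_

_⊕_ : ∀ {n} → Div n → Div n → Div n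
_⊕_ = zipWith ℤ._+_

_⊖_ : ∀ {n} → Div n → Div n → Div n
_⊖_ = zipWith ℤ._-_

_·_ : ∀ {n} → ℤ → Div n → Div n
k · D = map (k ℤ.*_) D

pt : ∀ {n} → Fin n → Div n
pt v = tabulate (λ w → if ⌊ v ≟ w ⌋ then 1ℤ else 0ℤ)

Laplacian : ∀ {n} → Graph n → (Fin n → ℤ) → Div n
Laplacian A f = tabulate (λ v → sumFin (λ w → + A v w ℤ.* (f v ℤ.- f w)))

Principal : ∀ {n} → Graph n → Div n → Set
Principal A D = ∃ λ (f : _ → ℤ) → D ≡ Laplacian A f

_∼⟨_⟩_ : ∀ {n} → Div n → Graph n → Div n → Set
D ∼⟨ A ⟩ D' = Principal A (D ⊖ D')

Effective : ∀ {n} → Div n → Set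
Effective E = ∀ v → 0ℤ ℤ.≤ lookup E v

InLinSys : ∀ {n} → Graph n → Div n → Div n → Set
InLinSys A D E = Effective E × E ∼⟨ A ⟩ D

-- m is the order of [v − q] in Jac(G)
IsOrder : ∀ {n} → Graph n → Fin n → Fin n → ℕ → Set
IsOrder A q v m =
  (1 ℕ.≤ m) × Principal A (+ m · (pt v ⊖ pt q))
  × (∀ k → 1 ℕ.≤ k → k ℕ.< m → ¬ Principal A (+ k · (pt v ⊖ pt q)))

-- E ∈ 𝔼_[D] = ⋃_k |D + k q|
InE : ∀ {n} → Graph n → Fin n → Div n → Div n → Set
InE A q D E = ∃ λ (k : ℕ) → InLinSys A (D ⊕ (+ k · pt q)) E

InS : ∀ {n} → Graph n → Fin n → (Fin n → ℕ) → Div n → Div n → Set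
InS A q ℓ D E = InE A q D E × (∀ v → lookup E v ℤ.< + ℓ v)

-- "the set {E : P E} is finite with exactly c elements":
-- there is a duplicate-free list enumerating exactly the E with P E, of length c
HasCard : ∀ {n} → (Div n → Set) → ℕ → Set
HasCard {n} P c = Σ (List (Div n)) λ xs →
  Unique xs × (∀ E → P E → E ∈ xs) × (∀ E → E ∈ xs → P E) × length xs ≡ c

-- formal power series over ℤ, as coefficient sequences
PS : Set
PS = ℕ → ℤ

sumUpTo : (ℕ → ℤ) → ℕ → ℤ
sumUpTo f zero = f zero
sumUpTo f (suc m) = sumUpTo f m ℤ.+ f (suc m)

_⋆_ : PS → PS → PS
(a ⋆ b) m = sumUpTo (λ i → a i ℤ.* b (m ∸ i)) m

onePS : PS
onePS i = if i ≡ᵇ 0 then 1ℤ else 0ℤ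

oneMinusZ^ : ℕ → PS
oneMinusZ^ ℓ i = onePS i ℤ.- (if i ≡ᵇ ℓ then 1ℤ else 0ℤ)

prodFin : ∀ {n} → (Fin n → PS) → PS
prodFin {zero} f = onePS
prodFin {suc n} f = f zero ⋆ prodFin (λ i → f (suc i))

module Submission where

-- Let c_R(k) count the E ∈ |D + kq| with E(w) < ℓ_w for every w ∈ R.  As ℓ_v (v − q) is
-- principal, E ↦ E + ℓ_v v maps |D + jq| bijectively onto the E ∈ |D + (ℓ_v + j)q| with
-- E(v) ≥ ℓ_v, keeping every other coordinate; and no E ∈ |D + kq| has E(v) ≥ ℓ_v when
-- k < ℓ_v, since E(v) ≤ deg E = k.  Hence c_R(k) = c_{R∪{v}}(k) + c_R(k − ℓ_v) for v ∉ R,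
-- i.e. C_R(z) (1 − z^ℓ_v) = C_{R∪{v}}(z).  Starting from C_∅ = Λ_[D] and adding the
-- vertices one by one gives Λ_[D] ∏_v (1 − z^ℓ_v) = C_V = S, again because deg E = k on
-- |D + kq|.

open import Defs
open import Data.Nat using (ℕ; _≤_)
open import Data.Nat.Divisibility using (_∣_)
open import Data.Integer using (ℤ; +_; 0ℤ)
open import Data.Fin using (Fin)
open import Data.Product using (∃; _×_)
open import Relation.Binary.PropositionalEquality using (_≡_)

open import Data.Nat as ℕ using (zero; suc; _∸_; z≤n; s≤s)
import Data.Nat.Properties as ℕ
open import Data.Nat.Divisibility using (divides)
open import Data.Integer as ℤ using (-[1+_]; 1ℤ; _+_; _*_; _-_; -_)
import Data.Integer.Properties as ℤ
open import Data.Integer.Tactic.RingSolver using (solve-∀)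
open import Data.Fin using (zero; suc; _≟_)
import Data.Fin.Properties as Fin
open import Data.Vec using ([]; _∷_; lookup)
import Data.Vec.Properties as Vec
open import Data.List using (List; []; _∷_; _++_; length; filter; map)
import Data.List.Properties as List
open import Data.List.Membership.Propositional using (_∈_)
open import Data.List.Membership.Propositional.Properties
  using (∈-∃++; ∈-++⁻; ∈-++⁺ˡ; ∈-++⁺ʳ; ∈-filter⁺; ∈-filter⁻; ∈-map⁺; ∈-map⁻)
open import Data.List.Relation.Unary.Any using (here; there)
import Data.List.Relation.Unary.All as All
open import Data.List.Relation.Unary.AllPairs using ([]; _∷_)
open import Data.List.Relation.Unary.Unique.Propositional using (Unique)
import Data.List.Relation.Unary.Unique.Propositional.Properties as Unique
open import Data.Product using (∃₂; _,_; proj₁; proj₂)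
open import Data.Sum using (_⊎_; inj₁; inj₂; [_,_]′)
open import Data.Empty using (⊥)
open import Data.Unit using (⊤; tt)
open import Data.Bool using (if_then_else_)
open import Function using (_∘_; id)
open import Function.Definitions using (Injective)
open import Relation.Unary using (Decidable)
open import Relation.Nullary using (¬_; yes; no; ¬?; contradiction)
open import Relation.Nullary.Decidable using (⌊_⌋)
open import Relation.Binary.PropositionalEquality using (refl; sym; trans; cong; cong₂; subst; _≢_; module ≡-Reasoning)
open ≡-Reasoning

private variable n : ℕ

-- Formal power series

sumUpTo-cong : ∀ m {f g : ℕ → ℤ} → (∀ i → i ℕ.≤ m → f i ≡ g i) → sumUpTo f m ≡ sumUpTo g m
sumUpTo-cong zero    f≗g = f≗g 0 z≤n
sumUpTo-cong (suc m) f≗g =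
  cong₂ _+_ (sumUpTo-cong m (λ i i≤m → f≗g i (ℕ.m≤n⇒m≤1+n i≤m))) (f≗g (suc m) ℕ.≤-refl)

sumUpTo-+ : ∀ m (f g : ℕ → ℤ) → sumUpTo (λ i → f i + g i) m ≡ sumUpTo f m + sumUpTo g m
sumUpTo-+ zero    f g = refl
sumUpTo-+ (suc m) f g = begin
  sumUpTo (λ i → f i + g i) m + (f (suc m) + g (suc m))
    ≡⟨ cong (_+ (f (suc m) + g (suc m))) (sumUpTo-+ m f g) ⟩
  (sumUpTo f m + sumUpTo g m) + (f (suc m) + g (suc m))
    ≡⟨ interchange (sumUpTo f m) (sumUpTo g m) (f (suc m)) (g (suc m)) ⟩
  (sumUpTo f m + f (suc m)) + (sumUpTo g m + g (suc m)) ∎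
  where
  interchange : ∀ a b c d → (a + b) + (c + d) ≡ (a + c) + (b + d)
  interchange = solve-∀

sumUpTo-*ˡ : ∀ m x (f : ℕ → ℤ) → sumUpTo (λ i → x * f i) m ≡ x * sumUpTo f m
sumUpTo-*ˡ zero    x f = refl
sumUpTo-*ˡ (suc m) x f =
  trans (cong (_+ x * f (suc m)) (sumUpTo-*ˡ m x f)) (sym (ℤ.*-distribˡ-+ x (sumUpTo f m) (f (suc m))))

sumUpTo-zero : ∀ m → sumUpTo (λ _ → 0ℤ) m ≡ 0ℤ
sumUpTo-zero zero    = refl
sumUpTo-zero (suc m) = trans (ℤ.+-identityʳ _) (sumUpTo-zero m)

sumUpTo-suc : ∀ m (f : ℕ → ℤ) → sumUpTo f (suc m) ≡ f 0 + sumUpTo (f ∘ suc) m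
sumUpTo-suc zero    f = refl
sumUpTo-suc (suc m) f =
  trans (cong (_+ f (suc (suc m))) (sumUpTo-suc m f)) (ℤ.+-assoc (f 0) (sumUpTo (f ∘ suc) m) (f (suc (suc m))))

⋆-suc : ∀ (a b : PS) m → (a ⋆ b) (suc m) ≡ a 0 * b (suc m) + ((a ∘ suc) ⋆ b) m
⋆-suc a b m = sumUpTo-suc m (λ i → a i * b (suc m ∸ i))

⋆-suc-last : ∀ (a b : PS) m → (a ⋆ b) (suc m) ≡ (a ⋆ (b ∘ suc)) m + a (suc m) * b 0
⋆-suc-last a b m = cong₂ _+_
  (sumUpTo-cong m (λ i i≤m → cong (λ t → a i * b t) (ℕ.+-∸-assoc 1 i≤m)))
  (cong (λ t → a (suc m) * b t) (ℕ.n∸n≡0 m))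

⋆-congˡ : ∀ {a a' : PS} (b : PS) m → (∀ i → a i ≡ a' i) → (a ⋆ b) m ≡ (a' ⋆ b) m
⋆-congˡ b m a≗a' = sumUpTo-cong m (λ i _ → cong (_* b (m ∸ i)) (a≗a' i))

⋆-linearˡ : ∀ x (a b c : PS) m → ((λ i → x * a i + b i) ⋆ c) m ≡ x * (a ⋆ c) m + (b ⋆ c) m
⋆-linearˡ x a b c m = begin
  sumUpTo (λ i → (x * a i + b i) * c (m ∸ i)) m
    ≡⟨ sumUpTo-cong m (λ i _ → distrib x (a i) (b i) (c (m ∸ i))) ⟩
  sumUpTo (λ i → x * (a i * c (m ∸ i)) + b i * c (m ∸ i)) m
    ≡⟨ sumUpTo-+ m _ _ ⟩
  sumUpTo (λ i → x * (a i * c (m ∸ i))) m + (b ⋆ c) m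
    ≡⟨ cong (_+ (b ⋆ c) m) (sumUpTo-*ˡ m x _) ⟩
  x * (a ⋆ c) m + (b ⋆ c) m ∎
  where
  distrib : ∀ x a b c → (x * a + b) * c ≡ x * (a * c) + b * c
  distrib = solve-∀

⋆-assoc : ∀ (a b c : PS) m → ((a ⋆ b) ⋆ c) m ≡ (a ⋆ (b ⋆ c)) m
⋆-assoc a b c zero    = ℤ.*-assoc (a 0) (b 0) (c 0)
⋆-assoc a b c (suc m) = begin
  ((a ⋆ b) ⋆ c) (suc m)
    ≡⟨ ⋆-suc (a ⋆ b) c m ⟩
  a 0 * b 0 * c (suc m) + (((a ⋆ b) ∘ suc) ⋆ c) m
    ≡⟨ cong (λ t → a 0 * b 0 * c (suc m) + t) (⋆-congˡ c m (⋆-suc a b)) ⟩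
  a 0 * b 0 * c (suc m) + ((λ i → a 0 * b (suc i) + ((a ∘ suc) ⋆ b) i) ⋆ c) m
    ≡⟨ cong (λ t → a 0 * b 0 * c (suc m) + t) (⋆-linearˡ (a 0) (b ∘ suc) ((a ∘ suc) ⋆ b) c m) ⟩
  a 0 * b 0 * c (suc m) + (a 0 * ((b ∘ suc) ⋆ c) m + (((a ∘ suc) ⋆ b) ⋆ c) m)
    ≡⟨ cong (λ t → a 0 * b 0 * c (suc m) + (a 0 * ((b ∘ suc) ⋆ c) m + t)) (⋆-assoc (a ∘ suc) b c m) ⟩
  a 0 * b 0 * c (suc m) + (a 0 * ((b ∘ suc) ⋆ c) m + ((a ∘ suc) ⋆ (b ⋆ c)) m)
    ≡⟨ regroup (a 0) (b 0) (c (suc m)) _ _ ⟩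
  a 0 * (b 0 * c (suc m) + ((b ∘ suc) ⋆ c) m) + ((a ∘ suc) ⋆ (b ⋆ c)) m
    ≡⟨ cong (λ t → a 0 * t + ((a ∘ suc) ⋆ (b ⋆ c)) m) (sym (⋆-suc b c m)) ⟩
  a 0 * (b ⋆ c) (suc m) + ((a ∘ suc) ⋆ (b ⋆ c)) m
    ≡⟨ sym (⋆-suc a (b ⋆ c) m) ⟩
  (a ⋆ (b ⋆ c)) (suc m) ∎
  where
  regroup : ∀ x y z u w → x * y * z + (x * u + w) ≡ x * (y * z + u) + w
  regroup = solve-∀

⋆-distribˡ-minus : ∀ (a b c : PS) m → (a ⋆ (λ i → b i - c i)) m ≡ (a ⋆ b) m - (a ⋆ c) m
⋆-distribˡ-minus a b c m = begin
  sumUpTo (λ i → a i * (b (m ∸ i) - c (m ∸ i))) m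
    ≡⟨ sumUpTo-cong m (λ i _ → distrib (a i) (b (m ∸ i)) (c (m ∸ i))) ⟩
  sumUpTo (λ i → a i * b (m ∸ i) + - 1ℤ * (a i * c (m ∸ i))) m
    ≡⟨ sumUpTo-+ m _ _ ⟩
  (a ⋆ b) m + sumUpTo (λ i → - 1ℤ * (a i * c (m ∸ i))) m
    ≡⟨ cong (λ t → (a ⋆ b) m + t) (trans (sumUpTo-*ˡ m (- 1ℤ) _) (ℤ.-1*i≡-i _)) ⟩
  (a ⋆ b) m - (a ⋆ c) m ∎
  where
  distrib : ∀ x y z → x * (y - z) ≡ x * y + - 1ℤ * (x * z)
  distrib = solve-∀

-- onePS = z^ 0 and oneMinusZ^ ℓ = onePS − z^ ℓ hold definitionally.
z^ : ℕ → PS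
z^ j i = if i ℕ.≡ᵇ j then 1ℤ else 0ℤ

⋆-z^-+ : ∀ (a : PS) j k → (a ⋆ z^ j) (j ℕ.+ k) ≡ a k
⋆-z^-+ a zero    zero    = ℤ.*-identityʳ (a 0)
⋆-z^-+ a zero    (suc k) = begin
  (a ⋆ z^ 0) (suc k)                       ≡⟨ ⋆-suc-last a (z^ 0) k ⟩
  (a ⋆ (λ _ → 0ℤ)) k + a (suc k) * 1ℤ     ≡⟨ cong₂ _+_ (sumUpTo-cong k (λ i _ → ℤ.*-zeroʳ (a i))) (ℤ.*-identityʳ _) ⟩
  sumUpTo (λ _ → 0ℤ) k + a (suc k)         ≡⟨ cong (_+ a (suc k)) (sumUpTo-zero k) ⟩
  0ℤ + a (suc k)                           ≡⟨ ℤ.+-identityˡ _ ⟩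
  a (suc k) ∎
⋆-z^-+ a (suc j) k = begin
  (a ⋆ z^ (suc j)) (suc (j ℕ.+ k))                     ≡⟨ ⋆-suc-last a (z^ (suc j)) (j ℕ.+ k) ⟩
  (a ⋆ z^ j) (j ℕ.+ k) + a (suc (j ℕ.+ k)) * 0ℤ       ≡⟨ cong₂ _+_ (⋆-z^-+ a j k) (ℤ.*-zeroʳ (a (suc (j ℕ.+ k)))) ⟩
  a k + 0ℤ                                             ≡⟨ ℤ.+-identityʳ (a k) ⟩
  a k ∎

⋆-z^-< : ∀ (a : PS) {j m} → m ℕ.< j → (a ⋆ z^ j) m ≡ 0ℤ
⋆-z^-< a {suc j} {zero}  _         = ℤ.*-zeroʳ (a 0)
⋆-z^-< a {suc j} {suc m} (s≤s m<j) = begin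
  (a ⋆ z^ (suc j)) (suc m)               ≡⟨ ⋆-suc-last a (z^ (suc j)) m ⟩
  (a ⋆ z^ j) m + a (suc m) * 0ℤ         ≡⟨ cong₂ _+_ (⋆-z^-< a m<j) (ℤ.*-zeroʳ (a (suc m))) ⟩
  0ℤ ∎

⋆-onePS : ∀ (a : PS) m → (a ⋆ onePS) m ≡ a m
⋆-onePS a = ⋆-z^-+ a 0

⋆-oneMinusZ^-< : ∀ (a : PS) {ℓ m} → m ℕ.< ℓ → (a ⋆ oneMinusZ^ ℓ) m ≡ a m
⋆-oneMinusZ^-< a {ℓ} {m} m<ℓ = begin
  (a ⋆ oneMinusZ^ ℓ) m               ≡⟨ ⋆-distribˡ-minus a onePS (z^ ℓ) m ⟩
  (a ⋆ onePS) m - (a ⋆ z^ ℓ) m       ≡⟨ cong₂ _-_ (⋆-onePS a m) (⋆-z^-< a m<ℓ) ⟩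
  a m - 0ℤ                           ≡⟨ ℤ.+-identityʳ (a m) ⟩
  a m ∎

⋆-oneMinusZ^-+ : ∀ (a : PS) ℓ j → (a ⋆ oneMinusZ^ ℓ) (ℓ ℕ.+ j) ≡ a (ℓ ℕ.+ j) - a j
⋆-oneMinusZ^-+ a ℓ j = trans (⋆-distribˡ-minus a onePS (z^ ℓ) (ℓ ℕ.+ j))
  (cong₂ _-_ (⋆-onePS a (ℓ ℕ.+ j)) (⋆-z^-+ a ℓ j))

⋆-oneMinusZ^-recurrence : ∀ ℓ {c c₁ c₂ : ℕ → ℕ} → (∀ k → c k ≡ c₁ k ℕ.+ c₂ k) →
  (∀ k → k ℕ.< ℓ → c₂ k ≡ 0) → (∀ j → c₂ (ℓ ℕ.+ j) ≡ c j) →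
  ∀ m → ((λ k → + c k) ⋆ oneMinusZ^ ℓ) m ≡ + c₁ m
⋆-oneMinusZ^-recurrence ℓ {c} {c₁} {c₂} c≡c₁+c₂ low high m with ℓ ℕ.≤? m
... | no ℓ≰m = begin
  ((λ k → + c k) ⋆ oneMinusZ^ ℓ) m   ≡⟨ ⋆-oneMinusZ^-< (λ k → + c k) m<ℓ ⟩
  + c m                              ≡⟨ cong +_ (c≡c₁+c₂ m) ⟩
  + (c₁ m ℕ.+ c₂ m)                  ≡⟨ cong (λ t → + (c₁ m ℕ.+ t)) (low m m<ℓ) ⟩
  + (c₁ m ℕ.+ 0)                     ≡⟨ cong +_ (ℕ.+-identityʳ (c₁ m)) ⟩
  + c₁ m ∎
  where
  m<ℓ : m ℕ.< ℓ
  m<ℓ = ℕ.≰⇒> ℓ≰m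
... | yes ℓ≤m = subst (λ m → ((λ k → + c k) ⋆ oneMinusZ^ ℓ) m ≡ + c₁ m) (ℕ.m+[n∸m]≡n ℓ≤m) (begin
  ((λ k → + c k) ⋆ oneMinusZ^ ℓ) (ℓ ℕ.+ j) ≡⟨ ⋆-oneMinusZ^-+ (λ k → + c k) ℓ j ⟩
  + c (ℓ ℕ.+ j) - + c j                   ≡⟨ cong (λ t → + t - + c j) (c≡c₁+c₂ (ℓ ℕ.+ j)) ⟩
  + (c₁ (ℓ ℕ.+ j) ℕ.+ c₂ (ℓ ℕ.+ j)) - + c j ≡⟨ cong (λ t → + (c₁ (ℓ ℕ.+ j) ℕ.+ t) - + c j) (high j) ⟩
  (+ c₁ (ℓ ℕ.+ j) + + c j) - + c j         ≡⟨ cancel (+ c₁ (ℓ ℕ.+ j)) (+ c j) ⟩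
  + c₁ (ℓ ℕ.+ j) ∎)
  where
  j : ℕ
  j = m ∸ ℓ
  cancel : ∀ x y → (x + y) - y ≡ x
  cancel = solve-∀

-- Divisors and linear equivalence

sumFin-cong : {f g : Fin n → ℤ} → (∀ i → f i ≡ g i) → sumFin f ≡ sumFin g
sumFin-cong {zero}  f≗g = refl
sumFin-cong {suc n} f≗g = cong₂ _+_ (f≗g zero) (sumFin-cong (f≗g ∘ suc))

sumFin-+ : (f g : Fin n → ℤ) → sumFin (λ i → f i + g i) ≡ sumFin f + sumFin g
sumFin-+ {zero}  f g = refl
sumFin-+ {suc n} f g = begin
  (f zero + g zero) + sumFin (λ i → f (suc i) + g (suc i))
    ≡⟨ cong (λ t → f zero + g zero + t) (sumFin-+ (f ∘ suc) (g ∘ suc)) ⟩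
  (f zero + g zero) + (sumFin (f ∘ suc) + sumFin (g ∘ suc))
    ≡⟨ interchange (f zero) (g zero) (sumFin (f ∘ suc)) (sumFin (g ∘ suc)) ⟩
  (f zero + sumFin (f ∘ suc)) + (g zero + sumFin (g ∘ suc)) ∎
  where
  interchange : ∀ a b c d → (a + b) + (c + d) ≡ (a + c) + (b + d)
  interchange = solve-∀

sumFin-*ˡ : ∀ k (f : Fin n → ℤ) → sumFin (λ i → k * f i) ≡ k * sumFin f
sumFin-*ˡ {zero}  k f = sym (ℤ.*-zeroʳ k)
sumFin-*ˡ {suc n} k f = trans (cong (λ t → k * f zero + t) (sumFin-*ˡ k (f ∘ suc)))
  (sym (ℤ.*-distribˡ-+ k (f zero) (sumFin (f ∘ suc))))

sumFin-zero : sumFin {n} (λ _ → 0ℤ) ≡ 0ℤ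
sumFin-zero {zero}  = refl
sumFin-zero {suc n} = trans (ℤ.+-identityˡ _) (sumFin-zero {n})

sumFin-swap : ∀ {m} (g : Fin m → Fin n → ℤ) →
  sumFin (λ v → sumFin (λ w → g v w)) ≡ sumFin (λ w → sumFin (λ v → g v w))
sumFin-swap {n} {m = zero}  g = sym (sumFin-zero {n})
sumFin-swap {m = suc m} g = begin
  sumFin (g zero) + sumFin (λ v → sumFin (g (suc v)))
    ≡⟨ cong (λ t → sumFin (g zero) + t) (sumFin-swap (g ∘ suc)) ⟩
  sumFin (g zero) + sumFin (λ w → sumFin (λ v → g (suc v) w))
    ≡⟨ sym (sumFin-+ (g zero) _) ⟩
  sumFin (λ w → g zero w + sumFin (λ v → g (suc v) w)) ∎

sumFin-single : (f : Fin n → ℤ) (v : Fin n) → (∀ w → w ≢ v → f w ≡ 0ℤ) → sumFin f ≡ f v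
sumFin-single {suc n} f zero    f≡0 = begin
  f zero + sumFin (f ∘ suc)      ≡⟨ cong (λ t → f zero + t) (trans (sumFin-cong (λ i → f≡0 (suc i) λ ())) (sumFin-zero {n})) ⟩
  f zero + 0ℤ                    ≡⟨ ℤ.+-identityʳ (f zero) ⟩
  f zero ∎
sumFin-single {suc n} f (suc v) f≡0 = begin
  f zero + sumFin (f ∘ suc)      ≡⟨ cong (_+ sumFin (f ∘ suc)) (f≡0 zero λ ()) ⟩
  0ℤ + sumFin (f ∘ suc)          ≡⟨ ℤ.+-identityˡ _ ⟩
  sumFin (f ∘ suc)               ≡⟨ sumFin-single (f ∘ suc) v (λ w w≢v → f≡0 (suc w) (w≢v ∘ Fin.suc-injective)) ⟩
  f (suc v) ∎

sumFin-nonneg : {f : Fin n → ℤ} → (∀ i → 0ℤ ℤ.≤ f i) → 0ℤ ℤ.≤ sumFin f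
sumFin-nonneg {zero}  f≥0 = ℤ.≤-refl
sumFin-nonneg {suc n} f≥0 = ℤ.+-mono-≤ (f≥0 zero) (sumFin-nonneg (f≥0 ∘ suc))

nonneg⇒≤sumFin : {f : Fin n → ℤ} → (∀ i → 0ℤ ℤ.≤ f i) → ∀ v → f v ℤ.≤ sumFin f
nonneg⇒≤sumFin {suc n} {f} f≥0 zero =
  ℤ.i≤i+j (f zero) (sumFin (f ∘ suc)) {{ℤ.nonNegative (sumFin-nonneg (f≥0 ∘ suc))}}
nonneg⇒≤sumFin {suc n} {f} f≥0 (suc v) =
  ℤ.≤-trans (nonneg⇒≤sumFin (f≥0 ∘ suc) v) (ℤ.i≤j+i (sumFin (f ∘ suc)) (f zero) {{ℤ.nonNegative (f≥0 zero)}})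

Div-ext : {X Y : Div n} → (∀ w → lookup X w ≡ lookup Y w) → X ≡ Y
Div-ext {X = X} {Y} X≗Y = trans (sym (Vec.tabulate∘lookup X)) (trans (Vec.tabulate-cong X≗Y) (Vec.tabulate∘lookup Y))

lookup-⊕ : (X Y : Div n) (w : Fin n) → lookup (X ⊕ Y) w ≡ lookup X w + lookup Y w
lookup-⊕ X Y w = Vec.lookup-zipWith _+_ w X Y

lookup-⊖ : (X Y : Div n) (w : Fin n) → lookup (X ⊖ Y) w ≡ lookup X w - lookup Y w
lookup-⊖ X Y w = Vec.lookup-zipWith _-_ w X Y

lookup-· : ∀ k (X : Div n) (w : Fin n) → lookup (k · X) w ≡ k * lookup X w
lookup-· k X w = Vec.lookup-map w (k *_) X

lookup-pt-same : (v : Fin n) → lookup (pt v) v ≡ 1ℤ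
lookup-pt-same v rewrite Vec.lookup∘tabulate (λ w → if ⌊ v ≟ w ⌋ then 1ℤ else 0ℤ) v with v ≟ v
... | yes _  = refl
... | no v≢v = contradiction refl v≢v

lookup-pt-other : {v w : Fin n} → w ≢ v → lookup (pt v) w ≡ 0ℤ
lookup-pt-other {v = v} {w} w≢v rewrite Vec.lookup∘tabulate (λ u → if ⌊ v ≟ u ⌋ then 1ℤ else 0ℤ) w with v ≟ w
... | yes v≡w = contradiction (sym v≡w) w≢v
... | no _    = refl

lookup-⊕·pt-same : ∀ (X : Div n) k v → lookup (X ⊕ k · pt v) v ≡ lookup X v + k
lookup-⊕·pt-same X k v = begin
  lookup (X ⊕ k · pt v) v      ≡⟨ lookup-⊕ X (k · pt v) v ⟩
  lookup X v + lookup (k · pt v) v ≡⟨ cong (λ t → lookup X v + t) (trans (lookup-· k (pt v) v) (cong (k *_) (lookup-pt-same v))) ⟩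
  lookup X v + k * 1ℤ          ≡⟨ cong (λ t → lookup X v + t) (ℤ.*-identityʳ k) ⟩
  lookup X v + k ∎

lookup-⊕·pt-other : ∀ (X : Div n) k {v w} → w ≢ v → lookup (X ⊕ k · pt v) w ≡ lookup X w
lookup-⊕·pt-other X k {v} {w} w≢v = begin
  lookup (X ⊕ k · pt v) w      ≡⟨ lookup-⊕ X (k · pt v) w ⟩
  lookup X w + lookup (k · pt v) w ≡⟨ cong (λ t → lookup X w + t) (trans (lookup-· k (pt v) w) (cong (k *_) (lookup-pt-other w≢v))) ⟩
  lookup X w + k * 0ℤ          ≡⟨ cong (λ t → lookup X w + t) (ℤ.*-zeroʳ k) ⟩
  lookup X w + 0ℤ              ≡⟨ ℤ.+-identityʳ (lookup X w) ⟩
  lookup X w ∎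

⊕·pt-Effective : ∀ (X : Div n) k v → (∀ w → w ≢ v → 0ℤ ℤ.≤ lookup X w) → 0ℤ ℤ.≤ lookup X v + k → Effective (X ⊕ k · pt v)
⊕·pt-Effective X k v X≥0 Xv+k≥0 w with w ≟ v
... | yes refl = subst (0ℤ ℤ.≤_) (sym (lookup-⊕·pt-same X k v)) Xv+k≥0
... | no w≢v   = subst (0ℤ ℤ.≤_) (sym (lookup-⊕·pt-other X k w≢v)) (X≥0 w w≢v)

⊕-⊖-interchange : (X X' Y Y' : Div n) → (X ⊕ X') ⊖ (Y ⊕ Y') ≡ (X ⊖ Y) ⊕ (X' ⊖ Y')
⊕-⊖-interchange [] [] [] [] = refl
⊕-⊖-interchange (x ∷ X) (x' ∷ X') (y ∷ Y) (y' ∷ Y') =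
  cong₂ _∷_ (interchange x x' y y') (⊕-⊖-interchange X X' Y Y')
  where
  interchange : ∀ a b c d → (a + b) - (c + d) ≡ (a - c) + (b - d)
  interchange = solve-∀

·-distribˡ-⊖ : ∀ k (X Y : Div n) → k · (X ⊖ Y) ≡ k · X ⊖ k · Y
·-distribˡ-⊖ k [] [] = refl
·-distribˡ-⊖ k (x ∷ X) (y ∷ Y) = cong₂ _∷_ (distrib k x y) (·-distribˡ-⊖ k X Y)
  where
  distrib : ∀ k x y → k * (x - y) ≡ k * x - k * y
  distrib = solve-∀

·-distribʳ-+ : ∀ (X Z : Div n) j k → (X ⊕ j · Z) ⊕ k · Z ≡ X ⊕ (k + j) · Z
·-distribʳ-+ [] [] j k = refl
·-distribʳ-+ (x ∷ X) (z ∷ Z) j k = cong₂ _∷_ (distrib x z j k) (·-distribʳ-+ X Z j k)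
  where
  distrib : ∀ x z j k → (x + j * z) + k * z ≡ x + (k + j) * z
  distrib = solve-∀

·-assoc : ∀ j k (X : Div n) → j · (k · X) ≡ (j * k) · X
·-assoc j k []      = refl
·-assoc j k (x ∷ X) = cong₂ _∷_ (sym (ℤ.*-assoc j k x)) (·-assoc j k X)

⊕-0·-identityʳ : (X Z : Div n) → X ⊕ 0ℤ · Z ≡ X
⊕-0·-identityʳ []      []      = refl
⊕-0·-identityʳ (x ∷ X) (z ∷ Z) = cong₂ _∷_ (ℤ.+-identityʳ x) (⊕-0·-identityʳ X Z)

⊕-·-cancel : ∀ (X Z : Div n) k → (X ⊕ k · Z) ⊕ (- k) · Z ≡ X
⊕-·-cancel X Z k = trans (·-distribʳ-+ X Z k (- k)) (trans (cong (λ j → X ⊕ j · Z) (ℤ.+-inverseˡ k)) (⊕-0·-identityʳ X Z))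

⊕-·-cancel′ : ∀ (X Z : Div n) k → (X ⊕ (- k) · Z) ⊕ k · Z ≡ X
⊕-·-cancel′ X Z k = trans (·-distribʳ-+ X Z (- k) k) (trans (cong (λ j → X ⊕ j · Z) (ℤ.+-inverseʳ k)) (⊕-0·-identityʳ X Z))

deg-⊕ : (X Y : Div n) → deg (X ⊕ Y) ≡ deg X + deg Y
deg-⊕ X Y = trans (sumFin-cong (lookup-⊕ X Y)) (sumFin-+ (lookup X) (lookup Y))

deg-· : ∀ k (X : Div n) → deg (k · X) ≡ k * deg X
deg-· k X = trans (sumFin-cong (lookup-· k X)) (sumFin-*ˡ k (lookup X))

deg-⊖ : (X Y : Div n) → deg (X ⊖ Y) ≡ deg X - deg Y
deg-⊖ X Y = begin
  deg (X ⊖ Y)                                  ≡⟨ sumFin-cong (λ w → trans (lookup-⊖ X Y w) (minus (lookup X w) (lookup Y w))) ⟩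
  sumFin (λ w → lookup X w + - 1ℤ * lookup Y w) ≡⟨ sumFin-+ (lookup X) _ ⟩
  deg X + sumFin (λ w → - 1ℤ * lookup Y w)     ≡⟨ cong (λ t → deg X + t) (trans (sumFin-*ˡ (- 1ℤ) (lookup Y)) (ℤ.-1*i≡-i (deg Y))) ⟩
  deg X - deg Y ∎
  where
  minus : ∀ x y → x - y ≡ x + - 1ℤ * y
  minus = solve-∀

deg-pt : (v : Fin n) → deg (pt v) ≡ 1ℤ
deg-pt v = trans (sumFin-single (lookup (pt v)) v (λ w → lookup-pt-other)) (lookup-pt-same v)

i≡-i⇒i≡0 : ∀ {i} → i ≡ - i → i ≡ 0ℤ
i≡-i⇒i≡0 {+ zero}   _  = refl
i≡-i⇒i≡0 {+ suc _}  ()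
i≡-i⇒i≡0 { -[1+ _ ]} ()

lookup-Laplacian : ∀ (A : Graph n) f v → lookup (Laplacian A f) v ≡ sumFin (λ w → + A v w * (f v - f w))
lookup-Laplacian A f v = Vec.lookup∘tabulate _ v

deg-Laplacian : (A : Graph n) → Symmetric A → ∀ f → deg (Laplacian A f) ≡ 0ℤ
deg-Laplacian {n} A sym-A f = trans (sumFin-cong (lookup-Laplacian A f)) (i≡-i⇒i≡0 (begin
  S                                                ≡⟨ sumFin-swap flow ⟩
  sumFin (λ w → sumFin (λ v → flow v w))           ≡⟨ sumFin-cong (λ w → sumFin-cong (λ v → antisymmetric v w)) ⟩
  sumFin (λ w → sumFin (λ v → - 1ℤ * flow w v))    ≡⟨ sumFin-cong (λ w → sumFin-*ˡ (- 1ℤ) (flow w)) ⟩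
  sumFin (λ w → - 1ℤ * sumFin (flow w))            ≡⟨ sumFin-*ˡ (- 1ℤ) (λ w → sumFin (flow w)) ⟩
  - 1ℤ * S                                         ≡⟨ ℤ.-1*i≡-i S ⟩
  - S ∎))
  where
  flow : Fin n → Fin n → ℤ
  flow v w = + A v w * (f v - f w)
  S : ℤ
  S = sumFin (λ v → sumFin (flow v))
  antisymmetric : ∀ v w → flow v w ≡ - 1ℤ * flow w v
  antisymmetric v w = begin
    + A v w * (f v - f w) ≡⟨ cong (λ a → + a * (f v - f w)) (sym-A v w) ⟩
    + A w v * (f v - f w) ≡⟨ swap (+ A w v) (f v) (f w) ⟩
    - 1ℤ * flow w v ∎
    where
    swap : ∀ a x y → a * (x - y) ≡ - 1ℤ * (a * (y - x))
    swap = solve-∀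

Laplacian-+ : (A : Graph n) (f g : Fin n → ℤ) → Laplacian A (λ v → f v + g v) ≡ Laplacian A f ⊕ Laplacian A g
Laplacian-+ {n} A f g = Div-ext λ v → begin
  lookup (Laplacian A (λ v → f v + g v)) v
    ≡⟨ lookup-Laplacian A (λ v → f v + g v) v ⟩
  sumFin (λ w → + A v w * ((f v + g v) - (f w + g w)))
    ≡⟨ sumFin-cong (λ w → distrib (+ A v w) (f v) (g v) (f w) (g w)) ⟩
  sumFin (λ w → + A v w * (f v - f w) + + A v w * (g v - g w))
    ≡⟨ sumFin-+ (λ w → + A v w * (f v - f w)) (λ w → + A v w * (g v - g w)) ⟩
  sumFin (λ w → + A v w * (f v - f w)) + sumFin (λ w → + A v w * (g v - g w))
    ≡⟨ sym (cong₂ _+_ (lookup-Laplacian A f v) (lookup-Laplacian A g v)) ⟩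
  lookup (Laplacian A f) v + lookup (Laplacian A g) v
    ≡⟨ sym (lookup-⊕ (Laplacian A f) (Laplacian A g) v) ⟩
  lookup (Laplacian A f ⊕ Laplacian A g) v ∎
  where
  distrib : ∀ a x y z u → a * ((x + y) - (z + u)) ≡ a * (x - z) + a * (y - u)
  distrib = solve-∀

Laplacian-* : ∀ (A : Graph n) k f → Laplacian A (λ v → k * f v) ≡ k · Laplacian A f
Laplacian-* A k f = Div-ext λ v → begin
  lookup (Laplacian A (λ v → k * f v)) v              ≡⟨ lookup-Laplacian A (λ v → k * f v) v ⟩
  sumFin (λ w → + A v w * (k * f v - k * f w))        ≡⟨ sumFin-cong (λ w → distrib k (+ A v w) (f v) (f w)) ⟩
  sumFin (λ w → k * (+ A v w * (f v - f w)))          ≡⟨ sumFin-*ˡ k (λ w → + A v w * (f v - f w)) ⟩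
  k * sumFin (λ w → + A v w * (f v - f w))            ≡⟨ cong (k *_) (sym (lookup-Laplacian A f v)) ⟩
  k * lookup (Laplacian A f) v                        ≡⟨ sym (lookup-· k (Laplacian A f) v) ⟩
  lookup (k · Laplacian A f) v ∎
  where
  distrib : ∀ k a x y → a * (k * x - k * y) ≡ k * (a * (x - y))
  distrib = solve-∀

module _ (A : Graph n) where

  Principal-⊕ : ∀ {X Y} → Principal A X → Principal A Y → Principal A (X ⊕ Y)
  Principal-⊕ (f , refl) (g , refl) = (λ v → f v + g v) , sym (Laplacian-+ A f g)

  Principal-· : ∀ k {X} → Principal A X → Principal A (k · X)
  Principal-· k (f , refl) = (λ v → k * f v) , sym (Laplacian-* A k f)

  Principal-∣ : ∀ {m l X} → m ∣ l → Principal A (+ m · X) → Principal A (+ l · X)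
  Principal-∣ {m} {X = X} (divides t refl) P =
    subst (Principal A) (trans (·-assoc (+ t) (+ m) X) (cong (_· X) (sym (ℤ.pos-* t m)))) (Principal-· (+ t) P)

  ∼-⊕ : ∀ {X Y X' Y'} → X ∼⟨ A ⟩ Y → X' ∼⟨ A ⟩ Y' → (X ⊕ X') ∼⟨ A ⟩ (Y ⊕ Y')
  ∼-⊕ {X} {Y} {X'} {Y'} X∼Y X'∼Y' =
    subst (Principal A) (sym (⊕-⊖-interchange X X' Y Y')) (Principal-⊕ X∼Y X'∼Y')

  ·-∼ : ∀ k {Z Z'} → Principal A (k · (Z ⊖ Z')) → (k · Z) ∼⟨ A ⟩ (k · Z')
  ·-∼ k {Z} {Z'} = subst (Principal A) (·-distribˡ-⊖ k Z Z')

  ∼-deg : Symmetric A → ∀ {X Y} → X ∼⟨ A ⟩ Y → deg X ≡ deg Y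
  ∼-deg sym-A {X} {Y} (f , X-Y≡Lf) = ℤ.i-j≡0⇒i≡j (deg X) (deg Y)
    (trans (sym (deg-⊖ X Y)) (trans (cong deg X-Y≡Lf) (deg-Laplacian A sym-A f)))

  ∼-shift : ∀ {E D' Z Z'} j k → Principal A (k · (Z ⊖ Z')) → E ∼⟨ A ⟩ (D' ⊕ j · Z') → (E ⊕ k · Z) ∼⟨ A ⟩ (D' ⊕ (k + j) · Z')
  ∼-shift {E} {D'} {Z} {Z'} j k P E∼D' =
    subst (λ Y → (E ⊕ k · Z) ∼⟨ A ⟩ Y) (·-distribʳ-+ D' Z' j k) (∼-⊕ E∼D' (·-∼ k P))

-- Finite cardinalities

Unique-⊆⇒length-≤ : ∀ {X : Set} {xs ys : List X} → Unique xs → (∀ x → x ∈ xs → x ∈ ys) → length xs ℕ.≤ length ys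
Unique-⊆⇒length-≤ {xs = []}     _             _     = z≤n
Unique-⊆⇒length-≤ {xs = x ∷ xs} (x∉xs ∷ !xs) xs⊆ys with ∈-∃++ (xs⊆ys x (here refl))
... | us , vs , refl = ℕ.≤-trans (s≤s (Unique-⊆⇒length-≤ !xs xs⊆us++vs)) (ℕ.≤-reflexive length-insert)
  where
  length-insert : suc (length (us ++ vs)) ≡ length (us ++ x ∷ vs)
  length-insert = begin
    suc (length (us ++ vs))          ≡⟨ cong suc (List.length-++ us) ⟩
    suc (length us ℕ.+ length vs)    ≡⟨ ℕ.+-suc (length us) (length vs) ⟨
    length us ℕ.+ length (x ∷ vs)    ≡⟨ List.length-++ us ⟨
    length (us ++ x ∷ vs) ∎
  xs⊆us++vs : ∀ y → y ∈ xs → y ∈ us ++ vs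
  xs⊆us++vs y y∈xs with ∈-++⁻ us (xs⊆ys y (there y∈xs))
  ... | inj₁ y∈us         = ∈-++⁺ˡ y∈us
  ... | inj₂ (here y≡x)   = contradiction (sym y≡x) (All.lookup x∉xs y∈xs)
  ... | inj₂ (there y∈vs) = ∈-++⁺ʳ us y∈vs

length-filter-∁ : ∀ {X : Set} {P : X → Set} (P? : Decidable P) xs →
  length xs ≡ length (filter P? xs) ℕ.+ length (filter (¬? ∘ P?) xs)
length-filter-∁ P? [] = refl
length-filter-∁ P? (x ∷ xs) with P? x
... | yes _ = cong suc (length-filter-∁ P? xs)
... | no _  = trans (cong suc (length-filter-∁ P? xs)) (sym (ℕ.+-suc _ _))

module _ {P Q : Div n → Set} where

  HasCard-resp : ∀ {c} → (∀ E → P E → Q E) → (∀ E → Q E → P E) → HasCard P c → HasCard Q c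
  HasCard-resp P⇒Q Q⇒P (xs , !xs , complete , sound , len) =
    xs , !xs , (λ E → complete E ∘ Q⇒P E) , (λ E → P⇒Q E ∘ sound E) , len

  HasCard-map : ∀ {c} (h : Div n → Div n) → (∀ {F F'} → h F ≡ h F' → F ≡ F') →
    (∀ F → P F → Q (h F)) → (∀ E → Q E → ∃ λ F → P F × h F ≡ E) → HasCard P c → HasCard Q c
  HasCard-map h h-injective P⇒Qh Q⇒Ph (xs , !xs , complete , sound , len) =
    map h xs , Unique.map⁺ h-injective !xs , complete′ , sound′ , trans (List.length-map h xs) len
    where
    complete′ : ∀ E → Q E → E ∈ map h xs
    complete′ E QE with Q⇒Ph E QE
    ... | F , PF , refl = ∈-map⁺ h (complete F PF)
    sound′ : ∀ E → E ∈ map h xs → Q E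
    sound′ E E∈ with ∈-map⁻ h E∈
    ... | F , F∈xs , refl = P⇒Qh F (sound F F∈xs)

  HasCard-split : ∀ {c} → Decidable Q → HasCard P c →
    ∃₂ λ c₁ c₂ → HasCard (λ E → P E × Q E) c₁ × HasCard (λ E → P E × ¬ Q E) c₂ × c ≡ c₁ ℕ.+ c₂
  HasCard-split Q? (xs , !xs , complete , sound , refl) =
    _ , _ , part Q? , part (¬? ∘ Q?) , length-filter-∁ Q? xs
    where
    part : ∀ {R : Div n → Set} (R? : Decidable R) → HasCard (λ E → P E × R E) (length (filter R? xs))
    part R? = filter R? xs , Unique.filter⁺ R? !xs
      , (λ E (PE , RE) → ∈-filter⁺ R? (complete E PE) RE)
      , (λ E E∈ → let E∈xs , RE = ∈-filter⁻ R? E∈ in sound E E∈xs , RE)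
      , refl

HasCard-unique : ∀ {P : Div n → Set} {c c'} → HasCard P c → HasCard P c' → c ≡ c'
HasCard-unique (xs , !xs , complete , sound , refl) (ys , !ys , complete' , sound' , refl) =
  ℕ.≤-antisym (Unique-⊆⇒length-≤ !xs (λ E → complete' E ∘ sound E))
              (Unique-⊆⇒length-≤ !ys (λ E → complete E ∘ sound' E))

HasCard-∅ : ∀ {P : Div n → Set} {c} → (∀ E → ¬ P E) → HasCard P c → c ≡ 0
HasCard-∅ ¬P card = HasCard-unique card ([] , [] , (λ E PE → contradiction PE (¬P E)) , (λ _ ()) , refl)

-- Counting effective divisors with bounded coefficients

module Counting {n} (A : Graph n) (sym-A : Symmetric A) (q : Fin n) (ℓ : Fin n → ℕ)
  (ℓ-principal : ∀ v → Principal A (+ ℓ v · (pt v ⊖ pt q))) (D : Div n) (deg-D : deg D ≡ 0ℤ) where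

  LinSys : ℕ → Div n → Set
  LinSys k = InLinSys A (D ⊕ + k · pt q)

  deg-LinSys : ∀ {k E} → LinSys k E → deg E ≡ + k
  deg-LinSys {k} {E} (_ , E∼D+kq) = begin
    deg E                        ≡⟨ ∼-deg A sym-A E∼D+kq ⟩
    deg (D ⊕ + k · pt q)         ≡⟨ deg-⊕ D (+ k · pt q) ⟩
    deg D + deg (+ k · pt q)     ≡⟨ cong₂ _+_ deg-D (trans (deg-· (+ k) (pt q)) (cong (+ k *_) (deg-pt q))) ⟩
    0ℤ + + k * 1ℤ                ≡⟨ trans (ℤ.+-identityˡ _) (ℤ.*-identityʳ (+ k)) ⟩
    + k ∎

  LinSys-entry≤ : ∀ {k E} v → LinSys k E → lookup E v ℤ.≤ + k
  LinSys-entry≤ v E∈ = ℤ.≤-trans (nonneg⇒≤sumFin (proj₁ E∈) v) (ℤ.≤-reflexive (deg-LinSys E∈))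

  Bounded : (Fin n → Set) → Div n → Set
  Bounded R E = ∀ w → R w → lookup E w ℤ.< + ℓ w

  Counts : (Fin n → Set) → (ℕ → ℕ) → Set
  Counts R c = ∀ k → HasCard (λ E → LinSys k E × Bounded R E) (c k)

  Counts-resp : ∀ {R R' c} → (∀ w → R w → R' w) → (∀ w → R' w → R w) → Counts R c → Counts R' c
  Counts-resp R⇒R' R'⇒R counts k = HasCard-resp
    (λ E (E∈ , bounded) → E∈ , λ w → bounded w ∘ R'⇒R w)
    (λ E (E∈ , bounded) → E∈ , λ w → bounded w ∘ R⇒R' w)
    (counts k)

  ⊕·pt-Bounded : ∀ {R} E k {v} → ¬ R v → Bounded R E → Bounded R (E ⊕ k · pt v)
  ⊕·pt-Bounded E k ¬Rv bounded w Rw =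
    subst (ℤ._< _) (sym (lookup-⊕·pt-other E k λ { refl → ¬Rv Rw })) (bounded w Rw)

  raise lower : Fin n → Div n → Div n
  raise v F = F ⊕ + ℓ v · pt v
  lower v E = E ⊕ (- + ℓ v) · pt v

  raise-LinSys : ∀ v {j F} → LinSys j F → LinSys (ℓ v ℕ.+ j) (raise v F)
  raise-LinSys v {j} {F} (F≥0 , F∼) =
    ⊕·pt-Effective F (+ ℓ v) v (λ w _ → F≥0 w) (ℤ.+-mono-≤ (F≥0 v) (ℤ.+≤+ ℕ.z≤n)) ,
    ∼-shift A (+ j) (+ ℓ v) (ℓ-principal v) F∼

  lower-LinSys : ∀ v {j E} → LinSys (ℓ v ℕ.+ j) E → + ℓ v ℤ.≤ lookup E v → LinSys j (lower v E)
  lower-LinSys v {j} {E} (E≥0 , E∼) ℓ≤Ev =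
    ⊕·pt-Effective E (- + ℓ v) v (λ w _ → E≥0 w) (ℤ.i≤j⇒0≤j-i ℓ≤Ev) ,
    subst (λ i → lower v E ∼⟨ A ⟩ (D ⊕ i · pt q)) (cancel (+ ℓ v) (+ j))
      (∼-shift A (+ (ℓ v ℕ.+ j)) (- + ℓ v) −ℓ-principal E∼)
    where
    cancel : ∀ a b → - a + (a + b) ≡ b
    cancel = solve-∀
    −ℓ-principal : Principal A ((- + ℓ v) · (pt v ⊖ pt q))
    −ℓ-principal = subst (Principal A)
      (trans (·-assoc (- 1ℤ) (+ ℓ v) _) (cong (_· (pt v ⊖ pt q)) (ℤ.-1*i≡-i (+ ℓ v))))
      (Principal-· A (- 1ℤ) (ℓ-principal v))

  raise-injective : ∀ v → Injective _≡_ _≡_ (raise v)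
  raise-injective v {F} {F'} raiseF≡raiseF' = begin
    F                  ≡⟨ sym (⊕-·-cancel F (pt v) (+ ℓ v)) ⟩
    lower v (raise v F)  ≡⟨ cong (lower v) raiseF≡raiseF' ⟩
    lower v (raise v F') ≡⟨ ⊕-·-cancel F' (pt v) (+ ℓ v) ⟩
    F' ∎

  Counts-insert : ∀ {R c} v → ¬ R v → Counts R c →
    ∃ λ c′ → Counts (λ w → R w ⊎ w ≡ v) c′ × (∀ m → ((λ k → + c k) ⋆ oneMinusZ^ (ℓ v)) m ≡ + c′ m)
  Counts-insert {R} {c} v ¬Rv counts =
    c₁ , counts₁ , ⋆-oneMinusZ^-recurrence (ℓ v) c≡c₁+c₂ c₂-below c₂-above
    where
    Below : Div n → Set
    Below E = lookup E v ℤ.< + ℓ v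
    split : ∀ k → ∃₂ λ c₁ c₂ → HasCard (λ E → (LinSys k E × Bounded R E) × Below E) c₁
                              × HasCard (λ E → (LinSys k E × Bounded R E) × ¬ Below E) c₂ × c k ≡ c₁ ℕ.+ c₂
    split k = HasCard-split (λ E → lookup E v ℤ.<? + ℓ v) (counts k)
    c₁ c₂ : ℕ → ℕ
    c₁ k = proj₁ (split k)
    c₂ k = proj₁ (proj₂ (split k))
    c≡c₁+c₂ : ∀ k → c k ≡ c₁ k ℕ.+ c₂ k
    c≡c₁+c₂ k = proj₂ (proj₂ (proj₂ (proj₂ (split k))))
    counts₁ : Counts (λ w → R w ⊎ w ≡ v) c₁
    counts₁ k = HasCard-resp
      (λ { E ((E∈ , bounded) , below) → E∈ , λ { w (inj₁ Rw) → bounded w Rw ; w (inj₂ refl) → below } })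
      (λ E (E∈ , bounded) → (E∈ , λ w → bounded w ∘ inj₁) , bounded v (inj₂ refl))
      (proj₁ (proj₂ (proj₂ (split k))))
    counts₂ : ∀ k → HasCard (λ E → (LinSys k E × Bounded R E) × ¬ Below E) (c₂ k)
    counts₂ k = proj₁ (proj₂ (proj₂ (proj₂ (split k))))
    c₂-below : ∀ k → k ℕ.< ℓ v → c₂ k ≡ 0
    c₂-below k k<ℓ = HasCard-∅
      (λ E ((E∈ , _) , ¬below) → ¬below (ℤ.≤-<-trans (LinSys-entry≤ v E∈) (ℤ.+<+ k<ℓ)))
      (counts₂ k)
    c₂-above : ∀ j → c₂ (ℓ v ℕ.+ j) ≡ c j
    c₂-above j = HasCard-unique (counts₂ (ℓ v ℕ.+ j)) (HasCard-map (raise v) (raise-injective v)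
      (λ F (F∈ , bounded) → (raise-LinSys v F∈ , ⊕·pt-Bounded F (+ ℓ v) ¬Rv bounded) , raised-not-below F∈)
      (λ E ((E∈ , bounded) , ¬below) → lower v E ,
        (lower-LinSys v E∈ (ℤ.≮⇒≥ ¬below) , ⊕·pt-Bounded E (- + ℓ v) ¬Rv bounded) ,
        ⊕-·-cancel′ E (pt v) (+ ℓ v))
      (counts j))
      where
      raised-not-below : ∀ {F} → LinSys j F → ¬ Below (raise v F)
      raised-not-below {F} (F≥0 , _) = ℤ.≤⇒≯ (subst (+ ℓ v ℤ.≤_) (sym (lookup-⊕·pt-same F (+ ℓ v) v))
        (ℤ.i≤j+i (+ ℓ v) (lookup F v) {{ℤ.nonNegative (F≥0 v)}}))

  Counts-insertAll : ∀ {m} (g : Fin m → Fin n) → Injective _≡_ _≡_ g → ∀ {R c} → (∀ i → ¬ R (g i)) → Counts R c →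
    ∃ λ c′ → Counts (λ w → R w ⊎ ∃ λ i → g i ≡ w) c′
           × (∀ k → ((λ k → + c k) ⋆ prodFin (oneMinusZ^ ∘ ℓ ∘ g)) k ≡ + c′ k)
  Counts-insertAll {zero} g _ {c = c} _ counts =
    c , Counts-resp (λ _ → inj₁) (λ { w (inj₁ Rw) → Rw ; w (inj₂ (() , _)) }) counts , ⋆-onePS (λ k → + c k)
  Counts-insertAll {suc m} g g-injective {R} {c} ¬Rg counts
    with Counts-insert (g zero) (¬Rg zero) counts
  ... | c₁ , counts₁ , c⋆[1-z^ℓ]≡c₁
    with Counts-insertAll (g ∘ suc) (Fin.suc-injective ∘ g-injective)
           (λ i → [ ¬Rg (suc i) , (λ ()) ∘ g-injective ]′) counts₁
  ... | c′ , counts′ , c₁⋆P≡c′ = c′ , Counts-resp regroup ungroup counts′ , λ k → begin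
    ((λ k → + c k) ⋆ (oneMinusZ^ (ℓ (g zero)) ⋆ P)) k   ≡⟨ ⋆-assoc (λ k → + c k) (oneMinusZ^ (ℓ (g zero))) P k ⟨
    (((λ k → + c k) ⋆ oneMinusZ^ (ℓ (g zero))) ⋆ P) k   ≡⟨ ⋆-congˡ P k c⋆[1-z^ℓ]≡c₁ ⟩
    ((λ k → + c₁ k) ⋆ P) k                              ≡⟨ c₁⋆P≡c′ k ⟩
    + c′ k ∎
    where
    P : PS
    P = prodFin (oneMinusZ^ ∘ ℓ ∘ g ∘ suc)
    regroup : ∀ w → (R w ⊎ w ≡ g zero) ⊎ (∃ λ i → g (suc i) ≡ w) → R w ⊎ ∃ λ i → g i ≡ w
    regroup w (inj₁ (inj₁ Rw))   = inj₁ Rw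
    regroup w (inj₁ (inj₂ w≡g0)) = inj₂ (zero , sym w≡g0)
    regroup w (inj₂ (i , gi≡w))  = inj₂ (suc i , gi≡w)
    ungroup : ∀ w → R w ⊎ (∃ λ i → g i ≡ w) → (R w ⊎ w ≡ g zero) ⊎ ∃ λ i → g (suc i) ≡ w
    ungroup w (inj₁ Rw)             = inj₁ (inj₁ Rw)
    ungroup w (inj₂ (zero , g0≡w))  = inj₁ (inj₂ (sym g0≡w))
    ungroup w (inj₂ (suc i , gi≡w)) = inj₂ (i , gi≡w)

  Counts-everywhere : ∀ {c} → Counts (λ _ → ⊥) c →
    ∃ λ c′ → Counts (λ _ → ⊤) c′ × (∀ k → ((λ k → + c k) ⋆ prodFin (oneMinusZ^ ∘ ℓ)) k ≡ + c′ k)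
  Counts-everywhere counts with Counts-insertAll id id (λ _ ()) counts
  ... | c′ , counts′ , c⋆P≡c′ = c′ , Counts-resp (λ _ _ → tt) (λ w _ → inj₂ (w , refl)) counts′ , c⋆P≡c′

  HasCard-InS : ∀ {c} → Counts (λ _ → ⊤) c → ∀ m → HasCard (λ F → InS A q ℓ D F × deg F ≡ + m) (c m)
  HasCard-InS counts m = HasCard-resp
    (λ F (F∈ , bounded) → ((m , F∈) , λ w → bounded w tt) , deg-LinSys F∈)
    (λ F (((k , F∈) , bounded) , degF≡m) →
      subst (λ j → LinSys j F) (ℤ.+-injective {k} {m} (trans (sym (deg-LinSys F∈)) degF≡m)) F∈ , λ w _ → bounded w)
    (counts m)

corollary3p2 : ∀ {n} (A : Graph n) → Symmetric A → Connected A
    → (q : Fin n) (ℓ : Fin n → ℕ)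
    → (∀ v → 1 ≤ ℓ v)
    → (∀ v → ∃ λ m → IsOrder A q v m × m ∣ ℓ v)
    → (D : Div n) → deg D ≡ 0ℤ
    → (lam s : ℕ → ℕ)
    → (∀ k → HasCard (InLinSys A (D ⊕ (+ k · pt q))) (lam k))
    → (∀ d → HasCard (λ F → InS A q ℓ D F × deg F ≡ + d) (s d))
    → ∀ m → ((λ k → + lam k) ⋆ prodFin (λ v → oneMinusZ^ (ℓ v))) m ≡ + s m
corollary3p2 A sym-A _ q ℓ _ order∣ℓ D deg-D lam s lam-card s-card m = begin
  ((λ k → + lam k) ⋆ prodFin (λ v → oneMinusZ^ (ℓ v))) m   ≡⟨ proj₂ (proj₂ everywhere) m ⟩
  + proj₁ everywhere m                                    ≡⟨ cong +_ (HasCard-unique (HasCard-InS (proj₁ (proj₂ everywhere)) m) (s-card m)) ⟩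
  + s m ∎
  where
  ℓ-principal : ∀ v → Principal A (+ ℓ v · (pt v ⊖ pt q))
  ℓ-principal v with order∣ℓ v
  ... | _ , (_ , order-principal , _) , order∣ℓv = Principal-∣ A order∣ℓv order-principal

  open Counting A sym-A q ℓ ℓ-principal D deg-D

  everywhere : ∃ λ c → Counts (λ _ → ⊤) c × (∀ k → ((λ k → + lam k) ⋆ prodFin (oneMinusZ^ ∘ ℓ)) k ≡ + c k)
  everywhere = Counts-everywhere (λ k → HasCard-resp (λ E E∈ → E∈ , λ _ ()) (λ _ → proj₁) (lam-card k))
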